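{- Let $t\geq 1$, $\ell\geq 3$, $k\geq t+\ell-2$ be integers and let $\mathcal{F}\subset\binom{[n]}{k}$ be a family such that $\binom{\ell}{2}(t-1)+\binom{\ell-1}{2}\leq \sum_{1\leq i<j\leq \ell}|F_i\cap F_j|$ for every choice of $\ell$ distinct members $F_1,\dots,F_\ell$ of $\mathcal{F}$. Suppose $\mathcal{F}$ contains a sunflower with a kernel $T$ of size $t$ and $2k+\ell-2$ petals. For $a\in T$ let $\mathcal{F}(T-\{a\},\bar a)=\{F\in\mathcal{F}: T\setminus\{a\}\subseteq F,\ a\notin F\}$. Then either all the families $\mathcal{F}(T-\{a\},\bar a)$ $(a\in T)$ are empty with at most one exception, or $$\sum_{a\in T}|\mathcal{F}(T-\{a\},\bar a)|= O(n^{k-t-\ell+2}),$$ where the implied constant depends only on $k,t,\ell$.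
   Context: $\binom{[n]}{k}$ denotes the family of all $k$-element subsets of $[n]=\{1,\dots,n\}$. A sunflower with kernel $T$ ($|T|=t$) and $u$ petals is a family of $u$ sets $T\cup P_1,\dots,T\cup P_u$ of size $k$, where $P_1,\dots,P_u$ (the petals) are pairwise disjoint and disjoint from $T$. -}

module Defs where

open import Data.Nat using (ℕ; zero; suc; _+_; _*_; _<_)
open import Data.Nat.Properties using (_<?_)
open import Data.Fin using (Fin; toℕ)
import Data.Fin as Fin
open import Data.Fin.Subset using (Subset; _∩_; _∪_; _-_; _⊆_; _∈_; _∉_; ∣_∣; ⊥)
open import Data.Fin.Subset.Properties using (_⊆?_; _∈?_)
open import Data.List using (List; filter; length)
open import Data.List.Membership.Propositional using () renaming (_∈_ to _∈ᴸ_)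
open import Data.List.Relation.Unary.Unique.Propositional using (Unique)
open import Data.Product using (_×_)
open import Relation.Nullary using (¬_; does)
open import Relation.Nullary.Decidable using (_×-dec_; ¬?)
open import Relation.Binary.PropositionalEquality using (_≡_)
open import Data.Bool using (if_then_else_)

∑ : ∀ {m} → (Fin m → ℕ) → ℕ
∑ {zero}  f = 0
∑ {suc m} f = f Fin.zero + ∑ (λ i → f (Fin.suc i))

pairInterSum : ∀ {n ℓ} → (Fin ℓ → Subset n) → ℕ
pairInterSum {n} {ℓ} F =
  ∑ λ i → ∑ λ j → if does (toℕ i <? toℕ j) then ∣ F i ∩ F j ∣ else 0

-- A family 𝓕 ⊆ ([n] choose k), given as a duplicate-free list of subsets of [n]
-- (element i : Fin n stands for i+1 ∈ [n]).
record Family (n k : ℕ) : Set where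
  field
    members : List (Subset n)
    unique  : Unique members
    uniform : ∀ {F} → F ∈ᴸ members → ∣ F ∣ ≡ k
open Family public

record SunflowerIn {n k : ℕ} (𝓕 : Family n k) (T : Subset n) (u : ℕ) : Set where
  field
    petal        : Fin u → Subset n
    petals-disj  : ∀ i j → ¬ (i ≡ j) → petal i ∩ petal j ≡ ⊥
    kernel-disj  : ∀ i → petal i ∩ T ≡ ⊥
    member       : ∀ i → (T ∪ petal i) ∈ᴸ members 𝓕
    size         : ∀ i → ∣ T ∪ petal i ∣ ≡ k
    distinct     : ∀ i j → T ∪ petal i ≡ T ∪ petal j → i ≡ j

𝓕[_-_,_̄] : ∀ {n k} → Family n k → Subset n → Fin n → List (Subset n)
𝓕[ 𝓕 - T , a ̄] = filter (λ G → ((T - a) ⊆? G) ×-dec ¬? (a ∈? G)) (members 𝓕)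

sumOverKernel : ∀ {n k} → Family n k → Subset n → ℕ
sumOverKernel 𝓕 T = ∑ λ a → if does (a ∈? T) then length 𝓕[ 𝓕 - T , a ̄] else 0

module Submission where

-- Suppose a ≠ b in T both have nonempty families; fix F ∈ 𝓕(T − {b}, b̄) and take
-- G ∈ 𝓕(T − {c}, c̄) with c ≠ b. At most ∣G ∪ F∣ ≤ 2k of the 2k + ℓ − 2 petals meet G ∪ F,
-- so ℓ − 2 sunflower members T ∪ Pⱼ avoid both. Together with G and F they are ℓ distinct
-- members of 𝓕 in which G and F meet each T ∪ Pⱼ in at most t − 1 points and two sunflower
-- members meet in T; the hypothesis then forces ∣G ∩ F∣ ≥ t + ℓ − 3, and b ∈ (G ∩ T) ∖ F gives
-- ∣G ∩ (T ∪ F)∣ ≥ t + ℓ − 2. So G is determined by its trace on the (t + k)-set T ∪ F and at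
-- most k − t − ℓ + 2 further points: at most 2^(t+k) (n + 1)^(k−t−ℓ+2) choices. For c = b use
-- a in place of b.

open import Defs
open import Data.Nat using (ℕ; zero; suc; _+_; _*_; _∸_; _^_; _≤_; _≥_; z≤n; s≤s)
open import Data.Nat.Properties
open import Data.Nat.Combinatorics using (_C_; nC1≡n; nCk+nC[k+1]≡[n+1]C[k+1])
open import Data.Nat.Solver using (module +-*-Solver)
open import Function using (_∘_)
open import Data.Bool using (Bool; true; false; if_then_else_)
open import Data.Fin using (Fin)
import Data.Fin as Fin
import Data.Fin.Properties as Finₚ
open import Data.Fin.Subset
open import Data.Fin.Subset.Properties
open import Data.Vec using ([]; _∷_; here; there)
import Data.Vec.Functional as Vector
open import Data.List using (List; []; _∷_; length)
open import Data.List.Relation.Unary.All using (All; []; _∷_)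
import Data.List.Relation.Unary.All as All
open import Data.List.Relation.Unary.AllPairs using ([]; _∷_)
open import Data.List.Relation.Unary.Unique.Propositional using (Unique)
open import Data.List.Relation.Unary.Unique.Propositional.Properties using (filter⁺)
open import Data.List.Relation.Unary.Any using (here; there)
open import Data.List.Membership.Propositional using () renaming (_∈_ to _∈ᴸ_)
open import Data.List.Membership.Propositional.Properties using (∈-filter⁻)
open import Data.Product using (Σ; _×_; _,_; proj₁; proj₂; ∃₂)
open import Data.Sum using (_⊎_; inj₁; inj₂)
import Data.Sum as Sum
open import Function.Definitions using (Injective)
open import Relation.Nullary using (¬_; does; yes; no; Dec; contradiction)
open import Relation.Nullary.Decidable using (_×-dec_; ¬?; decidable-stable)
open import Relation.Unary using (Decidable)
open import Relation.Binary.PropositionalEquality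

∑-≤-* : ∀ {m} (f : Fin m → ℕ) c → (∀ i → f i ≤ c) → ∑ f ≤ m * c
∑-≤-* {zero}  f c f≤c = z≤n
∑-≤-* {suc m} f c f≤c = +-mono-≤ (f≤c Fin.zero) (∑-≤-* (λ i → f (Fin.suc i)) c (λ i → f≤c (Fin.suc i)))

∑-restricted-≤-∣∣* : ∀ {n} (T : Subset n) (g : Fin n → ℕ) M → (∀ a → a ∈ T → g a ≤ M) →
  ∑ (λ a → if does (a ∈? T) then g a else 0) ≤ ∣ T ∣ * M
∑-restricted-≤-∣∣* []            g M g≤M = z≤n
∑-restricted-≤-∣∣* (true ∷ T)  g M g≤M =
  +-mono-≤ (g≤M Fin.zero here)
           (∑-restricted-≤-∣∣* T (λ a → g (Fin.suc a)) M (λ a a∈T → g≤M (Fin.suc a) (there a∈T)))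
∑-restricted-≤-∣∣* (false ∷ T) g M g≤M =
  ∑-restricted-≤-∣∣* T (λ a → g (Fin.suc a)) M (λ a a∈T → g≤M (Fin.suc a) (there a∈T))

pairInterSum-≤ : ∀ {n L} (G : Fin L → Subset n) s → (∀ i j → i ≢ j → ∣ G i ∩ G j ∣ ≤ s) →
  pairInterSum G ≤ (L C 2) * s
pairInterSum-≤ {L = zero}  G s G≤s = z≤n
pairInterSum-≤ {L = suc L} G s G≤s = begin
  ∑ (λ j → ∣ G Fin.zero ∩ G (Fin.suc j) ∣) + pairInterSum (λ i → G (Fin.suc i))
    ≤⟨ +-mono-≤ (∑-≤-* _ s (λ j → G≤s Fin.zero (Fin.suc j) (λ ())))
                (pairInterSum-≤ (λ i → G (Fin.suc i)) s
                   (λ i j i≢j → G≤s (Fin.suc i) (Fin.suc j) (i≢j ∘ Finₚ.suc-injective))) ⟩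
  L * s + (L C 2) * s   ≡⟨ *-distribʳ-+ s L (L C 2) ⟨
  (L + L C 2) * s       ≡⟨ cong (λ x → (x + L C 2) * s) (nC1≡n L) ⟨
  (L C 1 + L C 2) * s   ≡⟨ cong (_* s) (nCk+nC[k+1]≡[n+1]C[k+1] L 1) ⟩
  (suc L C 2) * s       ∎
  where open ≤-Reasoning

∣p∪q∣≤∣p∣+∣q∣ : ∀ {n} (p q : Subset n) → ∣ p ∪ q ∣ ≤ ∣ p ∣ + ∣ q ∣
∣p∪q∣≤∣p∣+∣q∣ []          []          = z≤n
∣p∪q∣≤∣p∣+∣q∣ (true ∷ p)  (x ∷ q)     = s≤s (≤-trans (∣p∪q∣≤∣p∣+∣q∣ p q) (+-monoʳ-≤ ∣ p ∣ (∣p∣≤∣x∷p∣ x q)))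
∣p∪q∣≤∣p∣+∣q∣ (false ∷ p) (true ∷ q)  = ≤-trans (s≤s (∣p∪q∣≤∣p∣+∣q∣ p q)) (≤-reflexive (sym (+-suc ∣ p ∣ ∣ q ∣)))
∣p∪q∣≤∣p∣+∣q∣ (false ∷ p) (false ∷ q) = ∣p∪q∣≤∣p∣+∣q∣ p q

∣p∣≡∣p∩q∣+∣p─q∣ : ∀ {n} (p q : Subset n) → ∣ p ∣ ≡ ∣ p ∩ q ∣ + ∣ p ─ q ∣
∣p∣≡∣p∩q∣+∣p─q∣ []          []          = refl
∣p∣≡∣p∩q∣+∣p─q∣ (true ∷ p)  (true ∷ q)  = cong suc (∣p∣≡∣p∩q∣+∣p─q∣ p q)
∣p∣≡∣p∩q∣+∣p─q∣ (true ∷ p)  (false ∷ q) = trans (cong suc (∣p∣≡∣p∩q∣+∣p─q∣ p q)) (sym (+-suc _ _))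
∣p∣≡∣p∩q∣+∣p─q∣ (false ∷ p) (true ∷ q)  = ∣p∣≡∣p∩q∣+∣p─q∣ p q
∣p∣≡∣p∩q∣+∣p─q∣ (false ∷ p) (false ∷ q) = ∣p∣≡∣p∩q∣+∣p─q∣ p q

p∩q≡⊥⇒x∉q : ∀ {n} {p q : Subset n} {x} → p ∩ q ≡ ⊥ → x ∈ p → x ∉ q
p∩q≡⊥⇒x∉q p∩q≡⊥ x∈p x∈q = ∉⊥ (subst (_ ∈_) p∩q≡⊥ (x∈p∩q⁺ (x∈p , x∈q)))

x∉p∧p∩[q-x]≡⊥⇒p∩q≡⊥ : ∀ {n} {p q : Subset n} {x} → x ∉ p → p ∩ (q - x) ≡ ⊥ → p ∩ q ≡ ⊥
x∉p∧p∩[q-x]≡⊥⇒p∩q≡⊥ {p = p} {q} x∉p p∩[q-x]≡⊥ = Empty-unique λ where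
  (y , y∈p∩q) → let y∈p , y∈q = x∈p∩q⁻ p q y∈p∩q in
    p∩q≡⊥⇒x∉q p∩[q-x]≡⊥ y∈p (x∈p∧x≢y⇒x∈p-y y∈q λ { refl → x∉p y∈p })

∩-kernel-⊆ : ∀ {n} {T P Q : Subset n} → P ∩ Q ≡ ⊥ → (T ∪ P) ∩ (T ∪ Q) ⊆ T
∩-kernel-⊆ {T = T} {P} {Q} P∩Q≡⊥ x∈ with x∈p∩q⁻ (T ∪ P) (T ∪ Q) x∈
... | x∈T∪P , x∈T∪Q with x∈p∪q⁻ T P x∈T∪P | x∈p∪q⁻ T Q x∈T∪Q
...   | inj₁ x∈T | _        = x∈T
...   | inj₂ _   | inj₁ x∈T = x∈T
...   | inj₂ x∈P | inj₂ x∈Q = contradiction x∈Q (p∩q≡⊥⇒x∉q P∩Q≡⊥ x∈P)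

∩-petal-⊆ : ∀ {n} {X T P : Subset n} {c} → c ∉ X → (∀ {x} → x ∈ P → x ∉ X) → X ∩ (T ∪ P) ⊆ T - c
∩-petal-⊆ {X = X} {T} {P} c∉X P∌X x∈ with x∈p∩q⁻ X (T ∪ P) x∈
... | x∈X , x∈T∪P with x∈p∪q⁻ T P x∈T∪P
...   | inj₁ x∈T = x∈p∧x≢y⇒x∈p-y x∈T λ { refl → c∉X x∈X }
...   | inj₂ x∈P = contradiction x∈X (P∌X x∈P)

∷-injective : ∀ {A : Set} {m} {x : A} {xs : Vector.Vector A m} →
  (∀ i → x ≢ xs i) → Injective _≡_ _≡_ xs → Injective _≡_ _≡_ (x Vector.∷ xs)
∷-injective x∉xs xs-inj {Fin.zero}  {Fin.zero}  _  = refl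
∷-injective x∉xs xs-inj {Fin.zero}  {Fin.suc j} eq = contradiction eq (x∉xs j)
∷-injective x∉xs xs-inj {Fin.suc i} {Fin.zero}  eq = contradiction (sym eq) (x∉xs i)
∷-injective x∉xs xs-inj {Fin.suc i} {Fin.suc j} eq = cong Fin.suc (xs-inj eq)

PairwiseDisjoint : ∀ {u n} → (Fin u → Subset n) → Set
PairwiseDisjoint P = ∀ i j → i ≢ j → P i ∩ P j ≡ ⊥

PairwiseDisjoint-tail : ∀ {u n} {P : Fin (suc u) → Subset n} →
  PairwiseDisjoint P → PairwiseDisjoint (P ∘ Fin.suc)
PairwiseDisjoint-tail P-disj i j i≢j = P-disj (Fin.suc i) (Fin.suc j) (i≢j ∘ Finₚ.suc-injective)

-- Each petal meeting H uses up a point of H, so at most ∣ H ∣ petals are lost.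
petals-avoiding : ∀ {u n} (P : Fin u → Subset n) → PairwiseDisjoint P →
  ∀ (H : Subset n) L → ∣ H ∣ + L ≤ u →
  Σ (Fin L → Fin u) λ σ → Injective _≡_ _≡_ σ × (∀ j → P (σ j) ∩ H ≡ ⊥)
petals-avoiding         P P-disj H zero    _ = (λ ()) , (λ {i} → λ { {()} }) , (λ ())
petals-avoiding {zero}  P P-disj H (suc L) H+L≤0 = contradiction (≤-trans (m≤n+m (suc L) ∣ H ∣) H+L≤0) (λ ())
petals-avoiding {suc u} P P-disj H (suc L) H+L≤u with nonempty? (P Fin.zero ∩ H)
... | no  P₀∩H-empty =
  let σ , σ-inj , σ-disj = petals-avoiding (P ∘ Fin.suc) (PairwiseDisjoint-tail P-disj) H L
                             (≤-pred (subst (_≤ suc u) (+-suc ∣ H ∣ L) H+L≤u))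
  in  (Fin.zero Vector.∷ (Fin.suc ∘ σ))
    , ∷-injective (λ j ()) (σ-inj ∘ Finₚ.suc-injective)
    , λ { Fin.zero → Empty-unique P₀∩H-empty ; (Fin.suc j) → σ-disj j }
... | yes (x , x∈P₀∩H) =
  let x∈P₀ , x∈H = x∈p∩q⁻ (P Fin.zero) H x∈P₀∩H
      σ , σ-inj , σ-disj = petals-avoiding (P ∘ Fin.suc) (PairwiseDisjoint-tail P-disj) (H - x) (suc L)
                             (≤-pred (≤-trans (+-monoˡ-≤ (suc L) (x∈p⇒∣p-x∣<∣p∣ x∈H)) H+L≤u))
  in  (Fin.suc ∘ σ) , (σ-inj ∘ Finₚ.suc-injective)
    , λ j → x∉p∧p∩[q-x]≡⊥⇒p∩q≡⊥ (p∩q≡⊥⇒x∉q (P-disj Fin.zero (Fin.suc (σ j)) (λ ())) x∈P₀) (σ-disj j)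

tailsWith : ∀ {n} → Bool → List (Subset (suc n)) → List (Subset n)
tailsWith b     []                 = []
tailsWith true  ((true  ∷ p) ∷ ps) = p ∷ tailsWith true ps
tailsWith true  ((false ∷ p) ∷ ps) = tailsWith true ps
tailsWith false ((true  ∷ p) ∷ ps) = tailsWith false ps
tailsWith false ((false ∷ p) ∷ ps) = p ∷ tailsWith false ps

length-tailsWith : ∀ {n} (ps : List (Subset (suc n))) →
  length ps ≡ length (tailsWith true ps) + length (tailsWith false ps)
length-tailsWith []                 = refl
length-tailsWith ((true  ∷ p) ∷ ps) = cong suc (length-tailsWith ps)
length-tailsWith ((false ∷ p) ∷ ps) = trans (cong suc (length-tailsWith ps)) (sym (+-suc _ _))

All-tailsWith : ∀ {n} {P : Subset (suc n) → Set} b (ps : List (Subset (suc n))) →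
  All P ps → All (P ∘ (b ∷_)) (tailsWith b ps)
All-tailsWith b     []                 []         = []
All-tailsWith true  ((true  ∷ q) ∷ ps) (Pq ∷ Pps) = Pq ∷ All-tailsWith true ps Pps
All-tailsWith true  ((false ∷ q) ∷ ps) (_  ∷ Pps) = All-tailsWith true ps Pps
All-tailsWith false ((true  ∷ q) ∷ ps) (_  ∷ Pps) = All-tailsWith false ps Pps
All-tailsWith false ((false ∷ q) ∷ ps) (Pq ∷ Pps) = Pq ∷ All-tailsWith false ps Pps

Unique-tailsWith : ∀ {n} b (ps : List (Subset (suc n))) → Unique ps → Unique (tailsWith b ps)
Unique-tailsWith b     []                 []           = []
Unique-tailsWith true  ((true  ∷ q) ∷ ps) (q∉ps ∷ ps!) =
  All.map (_∘ cong (true ∷_)) (All-tailsWith true ps q∉ps) ∷ Unique-tailsWith true ps ps!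
Unique-tailsWith true  ((false ∷ q) ∷ ps) (_    ∷ ps!) = Unique-tailsWith true ps ps!
Unique-tailsWith false ((true  ∷ q) ∷ ps) (_    ∷ ps!) = Unique-tailsWith false ps ps!
Unique-tailsWith false ((false ∷ q) ∷ ps) (q∉ps ∷ ps!) =
  All.map (_∘ cong (false ∷_)) (All-tailsWith false ps q∉ps) ∷ Unique-tailsWith false ps ps!

-- A coordinate in D is free (a factor 2); a coordinate outside D can only be in G by being
-- one of the at most m points of G ─ D (a factor n + 1 per unit of m).
length-≤-2^∣D∣*[1+n]^m : ∀ {n} m (D : Subset n) (Gs : List (Subset n)) → Unique Gs →
  All (λ G → ∣ G ─ D ∣ ≤ m) Gs → length Gs ≤ 2 ^ ∣ D ∣ * suc n ^ m
length-≤-2^∣D∣*[1+n]^m m [] [] _ _ = z≤n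
length-≤-2^∣D∣*[1+n]^m m [] ([] ∷ []) _ _ =
  ≤-reflexive (sym (trans (+-identityʳ (1 ^ m)) (^-zeroˡ m)))
length-≤-2^∣D∣*[1+n]^m m [] ([] ∷ [] ∷ _) ((≢[] ∷ _) ∷ _) _ = contradiction refl ≢[]
length-≤-2^∣D∣*[1+n]^m {suc n} m (true ∷ D) Gs Gs! small = begin
  length Gs
    ≡⟨ length-tailsWith Gs ⟩
  length (tailsWith true Gs) + length (tailsWith false Gs)
    ≤⟨ +-mono-≤ (recurse true) (recurse false) ⟩
  2 ^ ∣ D ∣ * suc n ^ m + 2 ^ ∣ D ∣ * suc n ^ m
    ≡⟨ solve 2 (λ a b → a :* b :+ a :* b := (con 2 :* a) :* b) refl (2 ^ ∣ D ∣) (suc n ^ m) ⟩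
  2 ^ suc ∣ D ∣ * suc n ^ m
    ≤⟨ *-monoʳ-≤ (2 ^ suc ∣ D ∣) (^-monoˡ-≤ m (n≤1+n (suc n))) ⟩
  2 ^ suc ∣ D ∣ * suc (suc n) ^ m
    ∎
  where
  open ≤-Reasoning
  open +-*-Solver
  recurse : ∀ b → length (tailsWith b Gs) ≤ 2 ^ ∣ D ∣ * suc n ^ m
  recurse b = length-≤-2^∣D∣*[1+n]^m m D (tailsWith b Gs) (Unique-tailsWith b Gs Gs!) (All-tailsWith b Gs small)
length-≤-2^∣D∣*[1+n]^m {suc n} zero (false ∷ D) Gs Gs! small = begin
  length Gs
    ≡⟨ length-tailsWith Gs ⟩
  length (tailsWith true Gs) + length (tailsWith false Gs)
    ≡⟨ cong (_+ length (tailsWith false Gs)) (length-[] (All-tailsWith true Gs small)) ⟩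
  length (tailsWith false Gs)
    ≤⟨ length-≤-2^∣D∣*[1+n]^m zero D (tailsWith false Gs) (Unique-tailsWith false Gs Gs!)
         (All-tailsWith false Gs small) ⟩
  2 ^ ∣ D ∣ * 1
    ∎
  where
  open ≤-Reasoning
  length-[] : ∀ {Hs : List (Subset n)} → All (λ H → suc ∣ H ─ D ∣ ≤ 0) Hs → length Hs ≡ 0
  length-[] []        = refl
  length-[] (() ∷ _)
length-≤-2^∣D∣*[1+n]^m {suc n} (suc m) (false ∷ D) Gs Gs! small = begin
  length Gs
    ≡⟨ length-tailsWith Gs ⟩
  length (tailsWith true Gs) + length (tailsWith false Gs)
    ≤⟨ +-mono-≤ (length-≤-2^∣D∣*[1+n]^m m D (tailsWith true Gs) (Unique-tailsWith true Gs Gs!)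
                   (All.map ≤-pred (All-tailsWith true Gs small)))
                (length-≤-2^∣D∣*[1+n]^m (suc m) D (tailsWith false Gs) (Unique-tailsWith false Gs Gs!)
                   (All-tailsWith false Gs small)) ⟩
  2 ^ ∣ D ∣ * suc n ^ m + 2 ^ ∣ D ∣ * suc n ^ suc m
    ≡⟨ solve 3 (λ a b c → a :* b :+ a :* (c :* b) := a :* (b :* (con 1 :+ c)))
               refl (2 ^ ∣ D ∣) (suc n ^ m) (suc n) ⟩
  2 ^ ∣ D ∣ * (suc n ^ m * suc (suc n))
    ≤⟨ *-monoʳ-≤ (2 ^ ∣ D ∣) (*-monoˡ-≤ (suc (suc n)) (^-monoˡ-≤ m (n≤1+n (suc n)))) ⟩
  2 ^ ∣ D ∣ * (suc (suc n) ^ m * suc (suc n))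
    ≡⟨ cong (2 ^ ∣ D ∣ *_) (*-comm (suc (suc n) ^ m) (suc (suc n))) ⟩
  2 ^ ∣ D ∣ * suc (suc n) ^ suc m
    ∎
  where
  open ≤-Reasoning
  open +-*-Solver

-- ([L+2] C 2) t + ([L+1] C 2) = (t + L) + R and the right-hand side is X + R, with R = 2Lt + (L C 2)(t + 1).
binomial-slack : ∀ t L X →
  (suc (suc L) C 2) * t + (suc L C 2) ≤ X + L * t + (L * t + (L C 2) * suc t) → t + L ≤ X
binomial-slack t L X ≤X+R = +-cancelʳ-≤ R (t + L) X (subst₂ _≤_ lhs rhs ≤X+R)
  where
  open +-*-Solver
  A R : ℕ
  A = L C 2
  R = L * t + L * t + A * t + A
  [1+L]C2 : suc L C 2 ≡ L + A
  [1+L]C2 = trans (sym (nCk+nC[k+1]≡[n+1]C[k+1] L 1)) (cong (_+ A) (nC1≡n L))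
  [2+L]C2 : suc (suc L) C 2 ≡ suc L + (L + A)
  [2+L]C2 = trans (sym (nCk+nC[k+1]≡[n+1]C[k+1] (suc L) 1)) (cong₂ _+_ (nC1≡n (suc L)) [1+L]C2)
  lhs : (suc (suc L) C 2) * t + (suc L C 2) ≡ (t + L) + R
  lhs = trans (cong₂ (λ x y → x * t + y) [2+L]C2 [1+L]C2)
    (solve 3 (λ l a t → ((con 1 :+ l) :+ (l :+ a)) :* t :+ (l :+ a)
                      := (t :+ l) :+ (l :* t :+ l :* t :+ a :* t :+ a)) refl L A t)
  rhs : X + L * t + (L * t + A * suc t) ≡ X + R
  rhs = solve 4 (λ x l a t → (x :+ l :* t) :+ (l :* t :+ a :* (con 1 :+ t))
                          := x :+ (l :* t :+ l :* t :+ a :* t :+ a)) refl X L A t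

_∈𝓕[_-_,_̄] : ∀ {n k} → Subset n → Family n k → Subset n → Fin n → Set
G ∈𝓕[ 𝓕 - T , a ̄] = G ∈ᴸ members 𝓕 × T - a ⊆ G × a ∉ G

∈-𝓕[-,̄]⁻ : ∀ {n k} {𝓕 : Family n k} {T a G} → G ∈ᴸ 𝓕[ 𝓕 - T , a ̄] → G ∈𝓕[ 𝓕 - T , a ̄]
∈-𝓕[-,̄]⁻ {𝓕 = 𝓕} = ∈-filter⁻ _ {xs = members 𝓕}

∈-other : ∀ {n} {T G : Subset n} {b c} → b ∈ T → c ≢ b → T - c ⊆ G → b ∈ G
∈-other b∈T c≢b T-c⊆G = T-c⊆G (x∈p∧x≢y⇒x∈p-y b∈T (c≢b ∘ sym))

_≟[] : ∀ {A : Set} (xs : List A) → Dec (xs ≡ [])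
[]      ≟[] = yes refl
(_ ∷ _) ≟[] = no λ ()

at-most-one⊎two : ∀ {n} {P : Fin n → Set} → Decidable P →
  (∀ a b → P a → P b → a ≡ b) ⊎ ∃₂ λ a b → a ≢ b × P a × P b
at-most-one⊎two P? with Finₚ.any? (λ a → Finₚ.any? (λ b → ¬? (a Finₚ.≟ b) ×-dec P? a ×-dec P? b))
... | yes (a , b , a≢b , Pa , Pb) = inj₂ (a , b , a≢b , Pa , Pb)
... | no ∄a,b = inj₁ λ a b Pa Pb → decidable-stable (a Finₚ.≟ b) λ a≢b → ∄a,b (a , b , a≢b , Pa , Pb)

IntersectionDense : ∀ {n k} → ℕ → ℕ → Family n k → Set
IntersectionDense {n} ℓ t 𝓕 = ∀ (G : Fin ℓ → Subset n) → Injective _≡_ _≡_ G → (∀ i → G i ∈ᴸ members 𝓕) →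
  (ℓ C 2) * (t ∸ 1) + ((ℓ ∸ 1) C 2) ≤ pairInterSum G

AtMostOneNonempty : ∀ {n k} → Family n k → Subset n → Set
AtMostOneNonempty 𝓕 T = ∀ a b → a ∈ T → b ∈ T → 𝓕[ 𝓕 - T , a ̄] ≢ [] → 𝓕[ 𝓕 - T , b ̄] ≢ [] → a ≡ b

module _ {n k u t L} (𝓕 : Family n k) (dense : IntersectionDense (suc (suc L)) (suc t) 𝓕)
         {T : Subset n} (∣T∣≡1+t : ∣ T ∣ ≡ suc t) (S : SunflowerIn 𝓕 T u) (enough-petals : 2 * k + L ≤ u) where

  open SunflowerIn S

  ∣G∩F∣-≥ : ∀ {b c G F} → b ∈ T → c ∈ T → c ≢ b → F ∈𝓕[ 𝓕 - T , b ̄] → G ∈𝓕[ 𝓕 - T , c ̄] →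
    t + L ≤ ∣ G ∩ F ∣
  ∣G∩F∣-≥ {b} {c} {G} {F} b∈T c∈T c≢b (F∈𝓕 , T-b⊆F , b∉F) (G∈𝓕 , T-c⊆G , c∉G) =
    binomial-slack t L ∣ G ∩ F ∣ (begin
      (suc (suc L) C 2) * t + (suc L C 2) ≤⟨ dense 𝒢 𝒢-injective 𝒢-members ⟩
      pairInterSum 𝒢
        ≤⟨ +-mono-≤ (+-monoʳ-≤ ∣ G ∩ F ∣ (∑-≤-* _ t (∣∩Sⱼ∣-≤ c∈T c∉G (petal∌ inj₁))))
                    (+-mono-≤ (∑-≤-* _ t (∣∩Sⱼ∣-≤ b∈T b∉F (petal∌ inj₂)))
                              (pairInterSum-≤ S′ (suc t) ∣Sᵢ∩Sⱼ∣-≤)) ⟩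
      ∣ G ∩ F ∣ + L * t + (L * t + (L C 2) * suc t) ∎)
    where
    open ≤-Reasoning
    H : Subset n
    H = G ∪ F
    ∣H∣≤2k : ∣ H ∣ ≤ 2 * k
    ∣H∣≤2k = ≤-trans (∣p∪q∣≤∣p∣+∣q∣ G F)
      (≤-reflexive (trans (cong₂ _+_ (uniform 𝓕 G∈𝓕) (uniform 𝓕 F∈𝓕)) (cong (k +_) (sym (+-identityʳ k)))))
    clean : Σ (Fin L → Fin u) λ σ → Injective _≡_ _≡_ σ × (∀ j → petal (σ j) ∩ H ≡ ⊥)
    clean = petals-avoiding petal petals-disj H L (≤-trans (+-monoˡ-≤ L ∣H∣≤2k) enough-petals)
    σ : Fin L → Fin u
    σ = proj₁ clean
    σ-injective : Injective _≡_ _≡_ σ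
    σ-injective = proj₁ (proj₂ clean)
    σ-avoids-H : ∀ j → petal (σ j) ∩ H ≡ ⊥
    σ-avoids-H = proj₂ (proj₂ clean)
    S′ : Fin L → Subset n
    S′ j = T ∪ petal (σ j)
    petal∌ : ∀ {X} → (∀ {x} → x ∈ X → x ∈ G ⊎ x ∈ F) → ∀ j {x} → x ∈ petal (σ j) → x ∉ X
    petal∌ X⊆H j x∈P x∈X = p∩q≡⊥⇒x∉q (σ-avoids-H j) x∈P (x∈p∪q⁺ (X⊆H x∈X))
    ∣∩Sⱼ∣-≤ : ∀ {X a} → a ∈ T → a ∉ X → (∀ j {x} → x ∈ petal (σ j) → x ∉ X) → ∀ j → ∣ X ∩ S′ j ∣ ≤ t
    ∣∩Sⱼ∣-≤ {X} {a} a∈T a∉X P∌X j = ≤-pred (begin-strict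
      ∣ X ∩ S′ j ∣ ≤⟨ p⊆q⇒∣p∣≤∣q∣ (∩-petal-⊆ {T = T} a∉X (P∌X j)) ⟩
      ∣ T - a ∣    <⟨ x∈p⇒∣p-x∣<∣p∣ a∈T ⟩
      ∣ T ∣        ≡⟨ ∣T∣≡1+t ⟩
      suc t        ∎)
    ∣Sᵢ∩Sⱼ∣-≤ : ∀ i j → i ≢ j → ∣ S′ i ∩ S′ j ∣ ≤ suc t
    ∣Sᵢ∩Sⱼ∣-≤ i j i≢j = ≤-trans (p⊆q⇒∣p∣≤∣q∣ (∩-kernel-⊆ {T = T} (petals-disj (σ i) (σ j) (i≢j ∘ σ-injective))))
                                 (≤-reflexive ∣T∣≡1+t)
    b∈G : b ∈ G
    b∈G = ∈-other b∈T c≢b T-c⊆G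
    ∈S′ : ∀ {a} → a ∈ T → ∀ j → a ∈ S′ j
    ∈S′ a∈T j = x∈p∪q⁺ (inj₁ a∈T)
    𝒢 : Fin (suc (suc L)) → Subset n
    𝒢 = G Vector.∷ F Vector.∷ S′
    𝒢-injective : Injective _≡_ _≡_ 𝒢
    𝒢-injective = ∷-injective
      (λ { Fin.zero    G≡F  → b∉F (subst (b ∈_) G≡F b∈G)
         ; (Fin.suc j) G≡Sⱼ → c∉G (subst (c ∈_) (sym G≡Sⱼ) (∈S′ c∈T j)) })
      (∷-injective (λ j F≡Sⱼ → b∉F (subst (b ∈_) (sym F≡Sⱼ) (∈S′ b∈T j)))
                   (λ Sᵢ≡Sⱼ → σ-injective (distinct _ _ Sᵢ≡Sⱼ)))
    𝒢-members : ∀ i → 𝒢 i ∈ᴸ members 𝓕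
    𝒢-members Fin.zero              = G∈𝓕
    𝒢-members (Fin.suc Fin.zero)    = F∈𝓕
    𝒢-members (Fin.suc (Fin.suc j)) = member (σ j)

  ∣G─[T∪F]∣-≤ : ∀ {b c G F} → b ∈ T → c ∈ T → c ≢ b → F ∈𝓕[ 𝓕 - T , b ̄] → G ∈𝓕[ 𝓕 - T , c ̄] →
    ∣ G ─ (T ∪ F) ∣ ≤ k ∸ suc (t + L)
  ∣G─[T∪F]∣-≤ {b} {c} {G} {F} b∈T c∈T c≢b F∈@(_ , _ , b∉F) G∈@(G∈𝓕 , T-c⊆G , _) =
    m+n≤o⇒m≤o∸n ∣ G ─ (T ∪ F) ∣ (begin
      ∣ G ─ (T ∪ F) ∣ + suc (t + L)   ≤⟨ +-monoʳ-≤ ∣ G ─ (T ∪ F) ∣ (begin-strict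
                                            t + L         ≤⟨ ∣G∩F∣-≥ b∈T c∈T c≢b F∈ G∈ ⟩
                                            ∣ G ∩ F ∣     <⟨ p⊂q⇒∣p∣<∣q∣ G∩F⊂G∩[T∪F] ⟩
                                            ∣ G ∩ (T ∪ F) ∣ ∎) ⟩
      ∣ G ─ (T ∪ F) ∣ + ∣ G ∩ (T ∪ F) ∣ ≡⟨ +-comm ∣ G ─ (T ∪ F) ∣ _ ⟩
      ∣ G ∩ (T ∪ F) ∣ + ∣ G ─ (T ∪ F) ∣ ≡⟨ ∣p∣≡∣p∩q∣+∣p─q∣ G (T ∪ F) ⟨
      ∣ G ∣                             ≡⟨ uniform 𝓕 G∈𝓕 ⟩
      k                                 ∎)
    where
    open ≤-Reasoning
    b∈G : b ∈ G
    b∈G = ∈-other b∈T c≢b T-c⊆G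
    G∩F⊂G∩[T∪F] : G ∩ F ⊂ G ∩ (T ∪ F)
    G∩F⊂G∩[T∪F] = (λ x∈ → let x∈G , x∈F = x∈p∩q⁻ G F x∈ in x∈p∩q⁺ (x∈G , x∈p∪q⁺ (inj₂ x∈F)))
                , b , x∈p∩q⁺ (b∈G , x∈p∪q⁺ (inj₁ b∈T)) , λ b∈G∩F → b∉F (proj₂ (x∈p∩q⁻ G F b∈G∩F))

  length-𝓕[-,̄]-≤ : ∀ {b c} → b ∈ T → c ∈ T → c ≢ b → 𝓕[ 𝓕 - T , b ̄] ≢ [] →
    length 𝓕[ 𝓕 - T , c ̄] ≤ 2 ^ (suc t + k) * suc n ^ (k ∸ suc (t + L))
  length-𝓕[-,̄]-≤ {b} {c} b∈T c∈T c≢b 𝓕[T-b,b̄]≢[] with 𝓕[ 𝓕 - T , b ̄] in eq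
  ... | [] = contradiction refl 𝓕[T-b,b̄]≢[]
  ... | F ∷ _ = ≤-trans
    (length-≤-2^∣D∣*[1+n]^m (k ∸ suc (t + L)) (T ∪ F) 𝓕[ 𝓕 - T , c ̄] (filter⁺ _ (unique 𝓕))
       (All.tabulate λ G∈ → ∣G─[T∪F]∣-≤ b∈T c∈T c≢b F∈ (∈-𝓕[-,̄]⁻ {𝓕 = 𝓕} G∈)))
    (*-monoˡ-≤ _ (^-monoʳ-≤ 2 (begin
      ∣ T ∪ F ∣     ≤⟨ ∣p∪q∣≤∣p∣+∣q∣ T F ⟩
      ∣ T ∣ + ∣ F ∣ ≡⟨ cong₂ _+_ ∣T∣≡1+t (uniform 𝓕 (proj₁ F∈)) ⟩
      suc t + k     ∎)))
    where
    open ≤-Reasoning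
    F∈ : F ∈𝓕[ 𝓕 - T , b ̄]
    F∈ = ∈-𝓕[-,̄]⁻ {𝓕 = 𝓕} (subst (F ∈ᴸ_) (sym eq) (here refl))

  AtMostOneNonempty⊎sumOverKernel-≤ :
    AtMostOneNonempty 𝓕 T ⊎ sumOverKernel 𝓕 T ≤ suc t * (2 ^ (suc t + k) * suc n ^ (k ∸ suc (t + L)))
  AtMostOneNonempty⊎sumOverKernel-≤ with at-most-one⊎two (λ a → (a ∈? T) ×-dec ¬? (𝓕[ 𝓕 - T , a ̄] ≟[]))
  ... | inj₁ unique = inj₁ λ a b a∈T b∈T a≢[] b≢[] → unique a b (a∈T , a≢[]) (b∈T , b≢[])
  ... | inj₂ (a , b , a≢b , (a∈T , a≢[]) , (b∈T , b≢[])) = inj₂ (begin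
    sumOverKernel 𝓕 T ≤⟨ ∑-restricted-≤-∣∣* T (λ c → length 𝓕[ 𝓕 - T , c ̄]) _ length-≤ ⟩
    ∣ T ∣ * _         ≡⟨ cong (_* _) ∣T∣≡1+t ⟩
    suc t * _         ∎)
    where
    open ≤-Reasoning
    length-≤ : ∀ c → c ∈ T → length 𝓕[ 𝓕 - T , c ̄] ≤ 2 ^ (suc t + k) * suc n ^ (k ∸ suc (t + L))
    length-≤ c c∈T with c Finₚ.≟ b
    ... | yes refl = length-𝓕[-,̄]-≤ a∈T c∈T (a≢b ∘ sym) a≢[]
    ... | no  c≢b  = length-𝓕[-,̄]-≤ b∈T c∈T c≢b b≢[]

[2+n]^m≤2^m*[1+n]^m : ∀ n m → suc (suc n) ^ m ≤ 2 ^ m * suc n ^ m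
[2+n]^m≤2^m*[1+n]^m n zero    = ≤-refl
[2+n]^m≤2^m*[1+n]^m n (suc m) = begin
  suc (suc n) * suc (suc n) ^ m  ≤⟨ *-mono-≤ 2+n≤2*[1+n] ([2+n]^m≤2^m*[1+n]^m n m) ⟩
  (2 * suc n) * (2 ^ m * suc n ^ m)
    ≡⟨ solve 3 (λ a b c → (con 2 :* a) :* (b :* c) := (con 2 :* b) :* (a :* c)) refl (suc n) (2 ^ m) (suc n ^ m) ⟩
  2 ^ suc m * suc n ^ suc m      ∎
  where
  open ≤-Reasoning
  open +-*-Solver
  2+n≤2*[1+n] : 2 + n ≤ 2 * suc n
  2+n≤2*[1+n] = ≤-trans (+-monoʳ-≤ 2 (m≤n*m n 2)) (≤-reflexive (sym (*-suc 2 n)))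

k+2∸[1+t+[2+L]]≡k∸[1+t+L] : ∀ k t L → k + 2 ∸ (suc t + suc (suc L)) ≡ k ∸ suc (t + L)
k+2∸[1+t+[2+L]]≡k∸[1+t+L] k t L = begin
  k + 2 ∸ (suc t + suc (suc L))
    ≡⟨ cong₂ _∸_ (+-comm k 2) (cong suc (trans (+-suc t (suc L)) (cong suc (+-suc t L)))) ⟩
  2 + k ∸ (2 + suc (t + L))
    ≡⟨ [m+n]∸[m+o]≡n∸o 2 k (suc (t + L)) ⟩
  k ∸ suc (t + L)
    ∎
  where open ≡-Reasoning

2k+[2+L]∸2≡2k+L : ∀ k L → 2 * k + suc (suc L) ∸ 2 ≡ 2 * k + L
2k+[2+L]∸2≡2k+L k L = trans (cong (_∸ 2) (+-suc (2 * k) (suc L))) (cong (_∸ 1) (+-suc (2 * k) L))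

kernel-dichotomy : ∀ n {k u t L} (𝓕 : Family n k) → IntersectionDense (suc (suc L)) (suc t) 𝓕 →
  ∀ {T} → ∣ T ∣ ≡ suc t → SunflowerIn 𝓕 T u → 2 * k + L ≤ u →
  AtMostOneNonempty 𝓕 T ⊎
    sumOverKernel 𝓕 T ≤ suc t * (2 ^ (suc t + k) * 2 ^ (k ∸ suc (t + L))) * n ^ (k ∸ suc (t + L))
kernel-dichotomy zero    𝓕 dense ∣T∣≡1+t S enough-petals = inj₂ z≤n
kernel-dichotomy (suc n) {k} {t = t} {L} 𝓕 dense {T} ∣T∣≡1+t S enough-petals =
  Sum.map₂ (λ sum≤ → begin
    sumOverKernel 𝓕 T
      ≤⟨ sum≤ ⟩
    suc t * (2 ^ (suc t + k) * suc (suc n) ^ m)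
      ≤⟨ *-monoʳ-≤ (suc t) (*-monoʳ-≤ (2 ^ (suc t + k)) ([2+n]^m≤2^m*[1+n]^m n m)) ⟩
    suc t * (2 ^ (suc t + k) * (2 ^ m * suc n ^ m))
      ≡⟨ solve 4 (λ a b c e → a :* (b :* (c :* e)) := (a :* (b :* c)) :* e)
                 refl (suc t) (2 ^ (suc t + k)) (2 ^ m) (suc n ^ m) ⟩
    suc t * (2 ^ (suc t + k) * 2 ^ m) * suc n ^ m
      ∎)
  (AtMostOneNonempty⊎sumOverKernel-≤ 𝓕 dense ∣T∣≡1+t S enough-petals)
  where
  open ≤-Reasoning
  open +-*-Solver
  m : ℕ
  m = k ∸ suc (t + L)

lemma5 : (t ℓ k : ℕ) → t ≥ 1 → ℓ ≥ 3 → k ≥ t + ℓ ∸ 2 →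
    Σ ℕ λ c → ∀ (n : ℕ) (𝓕 : Family n k) →
      (∀ (G : Fin ℓ → Subset n) → Injective _≡_ _≡_ G → (∀ i → G i ∈ᴸ members 𝓕) →
        (ℓ C 2) * (t ∸ 1) + ((ℓ ∸ 1) C 2) ≤ pairInterSum G) →
      ∀ (T : Subset n) → ∣ T ∣ ≡ t → SunflowerIn 𝓕 T (2 * k + ℓ ∸ 2) →
      (∀ a b → a ∈ T → b ∈ T → ¬ (𝓕[ 𝓕 - T , a ̄] ≡ []) → ¬ (𝓕[ 𝓕 - T , b ̄] ≡ []) → a ≡ b)
      ⊎ sumOverKernel 𝓕 T ≤ c * n ^ (k + 2 ∸ (t + ℓ))
lemma5 zero    ℓ             k () _ _
lemma5 (suc t) zero          k _ () _
lemma5 (suc t) (suc zero)    k _ (s≤s ()) _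
lemma5 (suc t) (suc (suc L)) k _ _ _ = c , λ n 𝓕 dense T ∣T∣≡1+t S →
  subst (λ e → AtMostOneNonempty 𝓕 T ⊎ sumOverKernel 𝓕 T ≤ c * n ^ e) (sym (k+2∸[1+t+[2+L]]≡k∸[1+t+L] k t L))
    (kernel-dichotomy n 𝓕 dense ∣T∣≡1+t S (≤-reflexive (sym (2k+[2+L]∸2≡2k+L k L))))
  where
  c : ℕ
  c = suc t * (2 ^ (suc t + k) * 2 ^ (k ∸ suc (t + L)))
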